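{- For each even $n\ge 8$, let $\rho_n^*$ be the permutation of $[n]$ whose one-line notation is $1,2$, followed by the odd numbers $3,5,\dots,n-1$ in increasing order, followed by $n$, followed by the even numbers $n-2,n-4,\dots,6,4$ in decreasing order; and let $\mu_n^*$ be the permutation of $[n]$ whose one-line notation is $2$, followed by the odd numbers $3,5,\dots,n-3$ in increasing order, followed by $n,n-1$, followed by the even numbers $n-2,n-4,\dots,6,4$ in decreasing order, followed by $1$. (E.g. $\rho_{10}^*=(1,2,3,5,7,9,10,8,6,4)$ and $\mu_{10}^*=(2,3,5,7,10,9,8,6,4,1)$.) Let $S_n$ be the bipartite graph with vertex set $A\cup B\cup C$, where $A=\{a_1,\dots,a_n\}$, $B=\{b_1,\dots,b_n\}$, $C=\{c_1,\dots,c_n\}$ are pairwise disjoint, and whose edges are exactly: $b_ia_j$ for all $i\in[n]$ and $1\le j\le\rho_n^*(i)$, and $b_ic_j$ for all $i\in[n]$ and $1\le j\le \mu_n^*(i)$. Then the sequence $S_8,S_{10},S_{12},\dots$ is an antichain with respect to the induced subgraph relation, i.e. for distinct even $m,n\ge 8$, $S_m$ is not isomorphic to an induced subgraph of $S_n$.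
   Context: All graphs are finite, simple and undirected. One-line notation $(\sigma(1),\dots,\sigma(n))$ lists the values of a permutation $\sigma$ of $[n]=\{1,\dots,n\}$. -}

module Defs where

open import Data.Nat using (ℕ; zero; suc; _+_; _*_; _∸_; _≤_)
open import Data.Fin using (Fin; toℕ)
open import Data.List using (List; []; _∷_; _++_; map; upTo; reverse)
open import Data.Product using (Σ; _×_)
open import Data.Empty using (⊥)
open import Function.Definitions using (Injective)
open import Relation.Binary.PropositionalEquality using (_≡_)

-- Throughout, n = 2 * k is the (even) size parameter.

oddsFrom3 : ℕ → List ℕ
oddsFrom3 c = map (λ i → 2 * i + 3) (upTo c)

evensDownTo4 : ℕ → List ℕ
evensDownTo4 c = reverse (map (λ i → 2 * i + 4) (upTo c))

rhoList : ℕ → List ℕ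
rhoList k = 1 ∷ 2 ∷ (oddsFrom3 (k ∸ 1) ++ (2 * k ∷ evensDownTo4 (k ∸ 2)))

muList : ℕ → List ℕ
muList k = 2 ∷ (oddsFrom3 (k ∸ 2) ++ (2 * k ∷ (2 * k ∸ 1) ∷ (evensDownTo4 (k ∸ 2) ++ (1 ∷ []))))

-- 1-indexed lookup (σ(i) for i ≥ 1); 0 outside range (never used in range)
at : List ℕ → ℕ → ℕ
at [] _ = 0
at (x ∷ xs) zero = 0
at (x ∷ xs) (suc zero) = x
at (x ∷ xs) (suc (suc i)) = at xs (suc i)

ρ* : ℕ → ℕ → ℕ
ρ* k = at (rhoList k)

μ* : ℕ → ℕ → ℕ
μ* k = at (muList k)

-- vertices of S_n: a_i, b_i, c_i with i ∈ [n]; index (j : Fin n) stands for j+1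
data Vertex (n : ℕ) : Set where
  a b c : Fin n → Vertex n

Adj : (k : ℕ) → Vertex (2 * k) → Vertex (2 * k) → Set
Adj k (b i) (a j) = suc (toℕ j) ≤ ρ* k (suc (toℕ i))
Adj k (a j) (b i) = suc (toℕ j) ≤ ρ* k (suc (toℕ i))
Adj k (b i) (c j) = suc (toℕ j) ≤ μ* k (suc (toℕ i))
Adj k (c j) (b i) = suc (toℕ j) ≤ μ* k (suc (toℕ i))
Adj k _ _ = ⊥

InducedSub : ℕ → ℕ → Set
InducedSub j k =
  Σ (Vertex (2 * j) → Vertex (2 * k)) λ f →
    Injective _≡_ _≡_ f ×
    (∀ u v → (Adj j u v → Adj k (f u) (f v)) × (Adj k (f u) (f v) → Adj j u v))

module Submission where

open import Defs
open import Data.Nat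
open import Data.Nat.Properties
open import Data.Nat.Tactic.RingSolver using (solve)
open import Data.List using (List; []; _∷_; _++_; length; reverse; applyUpTo; applyDownFrom)
open import Data.List.Properties using (map-applyUpTo; reverse-applyUpTo; length-applyUpTo; length-applyDownFrom)
open import Data.Fin using (Fin; toℕ; fromℕ<; zero)
open import Data.Fin.Properties using (toℕ-fromℕ<; toℕ-injective; toℕ<n; injective⇒≤)
open import Data.Product using (Σ; _×_; _,_; proj₁; proj₂)
open import Data.Sum using (_⊎_; inj₁; inj₂; swap)
import Data.Sum as Sum
open import Data.Unit using (⊤; tt)
open import Data.Empty using (⊥; ⊥-elim)
open import Data.Bool using (Bool; true; false; T)
open import Function using (id; _∘_)
open import Function.Definitions using (Injective)
open import Relation.Nullary using (¬_; yes; no)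
open import Relation.Binary.PropositionalEquality

-- Write j = q + 4, k = r + 4.  The vertex b_i is adjacent to a_1 … a_{ρ*(i)}
-- and c_1 … c_{μ*(i)}, so two B-vertices are mutually separated (each has a
-- neighbour the other lacks) iff ρ* and μ* order them oppositely.  This
-- "crossing graph" on B is computed explicitly (Profile evaluates ρ*, μ* on
-- each block of positions, CrossingGraph lists the crossing pairs): it is a
-- vertex hub with two pendant leaves, joined by a path with 2r + 3 edges to
-- a triangle, its only triangle; hub and apex are its only vertices of
-- degree three.  Rigidity: an injective homomorphism from the crossing graph
-- for q into the one for r fixes hub and the triangle, so r ≤ q.
--
-- Now let f embed S_{2j} into S_{2k} as an induced subgraph (Embedding).
-- The vertex a_1 is adjacent to all of B.  If f(a_1) ∈ B, then f maps B into
-- A ∪ C; but A-vertices (and C-vertices) have nested neighbourhoods, so the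
-- three pairwise crossing triangle vertices would need three different parts
-- among A, C.  Hence f maps B injectively into B, giving q ≤ r, and f induces
-- an injective homomorphism of crossing graphs, giving r ≤ q.

-- Doubling, defined by recursion so that inequalities between doubled
-- numbers can be taken apart by pattern matching on s≤s.
double : ℕ → ℕ
double zero    = zero
double (suc n) = suc (suc (double n))

2*≡double : ∀ n → 2 * n ≡ double n
2*≡double zero    = refl
2*≡double (suc n) = trans (cong suc (+-suc n (n + 0))) (cong (λ x → suc (suc x)) (2*≡double n))

+≡double : ∀ n → n + n ≡ double n
+≡double n = trans (cong (n +_) (sym (+-identityʳ n))) (2*≡double n)

n≤double : ∀ n → n ≤ double n
n≤double zero    = z≤n
n≤double (suc n) = s≤s (≤-trans (n≤double n) (n≤1+n _))

double-mono-≤ : ∀ {x y} → x ≤ y → double x ≤ double y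
double-mono-≤ z≤n     = z≤n
double-mono-≤ (s≤s p) = s≤s (s≤s (double-mono-≤ p))

double-cancel-≤ : ∀ {x y} → double x ≤ double y → x ≤ y
double-cancel-≤ {zero}          _             = z≤n
double-cancel-≤ {suc x} {suc y} (s≤s (s≤s p)) = s≤s (double-cancel-≤ p)

double-cancel-< : ∀ {x y} → suc (double x) ≤ double y → x < y
double-cancel-< {zero}  {suc y} _             = s≤s z≤n
double-cancel-< {suc x} {suc y} (s≤s (s≤s p)) = s≤s (double-cancel-< p)

pigeonhole : ∀ {A : Set} {x y u₁ u₂ u₃ : A} → u₁ ≡ x ⊎ u₁ ≡ y → u₂ ≡ x ⊎ u₂ ≡ y → u₃ ≡ x ⊎ u₃ ≡ y →
             u₁ ≢ u₂ → u₁ ≢ u₃ → u₂ ≢ u₃ → ⊥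
pigeonhole (inj₁ refl) (inj₁ refl) _           u₁≢u₂ _     _     = u₁≢u₂ refl
pigeonhole (inj₂ refl) (inj₂ refl) _           u₁≢u₂ _     _     = u₁≢u₂ refl
pigeonhole (inj₁ refl) _           (inj₁ refl) _     u₁≢u₃ _     = u₁≢u₃ refl
pigeonhole (inj₂ refl) _           (inj₂ refl) _     u₁≢u₃ _     = u₁≢u₃ refl
pigeonhole _           (inj₁ refl) (inj₁ refl) _     _     u₂≢u₃ = u₂≢u₃ refl
pigeonhole _           (inj₂ refl) (inj₂ refl) _     _     u₂≢u₃ = u₂≢u₃ refl

two-colours : ∀ {x y z : Bool} → x ≢ y → y ≢ z → x ≢ z → ⊥
two-colours {false} {false} x≢y _   _   = x≢y refl
two-colours {true}  {true}  x≢y _   _   = x≢y refl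
two-colours {false} {true}  {false} _ _   x≢z = x≢z refl
two-colours {false} {true}  {true}  _ y≢z _   = y≢z refl
two-colours {true}  {false} {false} _ y≢z _   = y≢z refl
two-colours {true}  {false} {true}  _ _   x≢z = x≢z refl

between : ∀ {s t} → s ≤ t → t ≤ suc s → t ≡ s ⊎ t ≡ suc s
between s≤t t≤1+s with m≤n⇒m<n∨m≡n t≤1+s
... | inj₁ (s≤s t≤s) = inj₁ (≤-antisym t≤s s≤t)
... | inj₂ t≡1+s     = inj₂ t≡1+s

beyond : ∀ {t r} l m {_ : T (m ≤ᵇ l)} → t ≤ r → ¬ (l + double r < m + double t)
beyond l m {m≤l} t≤r lt = <⇒≱ lt (+-mono-≤ (≤ᵇ⇒≤ m l m≤l) (double-mono-≤ t≤r))

incomparable⇒crossing : ∀ {x₁ y₁ x₂ y₂} → x₂ < x₁ ⊎ y₂ < y₁ → x₁ < x₂ ⊎ y₁ < y₂ →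
                        (x₁ < x₂ × y₂ < y₁) ⊎ (x₂ < x₁ × y₁ < y₂)
incomparable⇒crossing (inj₁ x₂<x₁) (inj₁ x₁<x₂) = ⊥-elim (<-asym x₂<x₁ x₁<x₂)
incomparable⇒crossing (inj₁ x₂<x₁) (inj₂ y₁<y₂) = inj₂ (x₂<x₁ , y₁<y₂)
incomparable⇒crossing (inj₂ y₂<y₁) (inj₁ x₁<x₂) = inj₁ (x₁<x₂ , y₂<y₁)
incomparable⇒crossing (inj₂ y₂<y₁) (inj₂ y₁<y₂) = ⊥-elim (<-asym y₂<y₁ y₁<y₂)

at-applyUpTo : ∀ (f : ℕ → ℕ) m t → t < m → at (applyUpTo f m) (suc t) ≡ f t
at-applyUpTo f (suc m) zero    _       = refl
at-applyUpTo f (suc m) (suc t) (s≤s p) = at-applyUpTo (f ∘ suc) m t p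

at-applyDownFrom : ∀ (f : ℕ → ℕ) m t → t < m → at (applyDownFrom f m) (suc t) ≡ f (m ∸ suc t)
at-applyDownFrom f (suc m) zero    _       = refl
at-applyDownFrom f (suc m) (suc t) (s≤s p) = at-applyDownFrom f m t p

at-++ˡ : ∀ (xs ys : List ℕ) i → i < length xs → at (xs ++ ys) (suc i) ≡ at xs (suc i)
at-++ˡ (x ∷ xs) ys zero    _       = refl
at-++ˡ (x ∷ xs) ys (suc i) (s≤s p) = at-++ˡ xs ys i p

at-++ʳ : ∀ (xs ys : List ℕ) i → at (xs ++ ys) (suc (length xs + i)) ≡ at ys (suc i)
at-++ʳ []       ys i = refl
at-++ʳ (x ∷ xs) ys i = at-++ʳ xs ys i

oddsFrom3≡ : ∀ m → oddsFrom3 m ≡ applyUpTo (λ i → 2 * i + 3) m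
oddsFrom3≡ m = map-applyUpTo id _ m

evensDownTo4≡ : ∀ m → evensDownTo4 m ≡ applyDownFrom (λ i → 2 * i + 4) m
evensDownTo4≡ m = trans (cong reverse (map-applyUpTo id _ m)) (reverse-applyUpTo _ m)

length-oddsFrom3 : ∀ m → length (oddsFrom3 m) ≡ m
length-oddsFrom3 m = trans (cong length (oddsFrom3≡ m)) (length-applyUpTo _ m)

length-evensDownTo4 : ∀ m → length (evensDownTo4 m) ≡ m
length-evensDownTo4 m = trans (cong length (evensDownTo4≡ m)) (length-applyDownFrom _ m)

odds-at : ∀ m ys t → t < m → at (oddsFrom3 m ++ ys) (suc t) ≡ 3 + double t
odds-at m ys t t<m = begin
  at (oddsFrom3 m ++ ys) (suc t)  ≡⟨ at-++ˡ (oddsFrom3 m) ys t (subst (t <_) (sym (length-oddsFrom3 m)) t<m) ⟩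
  at (oddsFrom3 m) (suc t)        ≡⟨ cong (λ l → at l (suc t)) (oddsFrom3≡ m) ⟩
  at (applyUpTo _ m) (suc t)      ≡⟨ at-applyUpTo _ m t t<m ⟩
  2 * t + 3                       ≡⟨ +-comm (2 * t) 3 ⟩
  3 + 2 * t                       ≡⟨ cong (3 +_) (2*≡double t) ⟩
  3 + double t                    ∎
  where open ≡-Reasoning

evens-at : ∀ m t → t < m → at (evensDownTo4 m) (suc t) ≡ 4 + double (m ∸ suc t)
evens-at m t t<m = begin
  at (evensDownTo4 m) (suc t)     ≡⟨ cong (λ l → at l (suc t)) (evensDownTo4≡ m) ⟩
  at (applyDownFrom _ m) (suc t)  ≡⟨ at-applyDownFrom _ m t t<m ⟩
  2 * (m ∸ suc t) + 4             ≡⟨ +-comm (2 * (m ∸ suc t)) 4 ⟩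
  4 + 2 * (m ∸ suc t)             ≡⟨ cong (4 +_) (2*≡double (m ∸ suc t)) ⟩
  4 + double (m ∸ suc t)          ∎
  where open ≡-Reasoning

evens-at-++ : ∀ m ys t → t < m → at (evensDownTo4 m ++ ys) (suc t) ≡ 4 + double (m ∸ suc t)
evens-at-++ m ys t t<m =
  trans (at-++ˡ (evensDownTo4 m) ys t (subst (t <_) (sym (length-evensDownTo4 m)) t<m)) (evens-at m t t<m)

odds-past : ∀ m ys x i → x ≡ m + i → at (oddsFrom3 m ++ ys) (suc x) ≡ at ys (suc i)
odds-past m ys _ i refl = subst (λ l → at (oddsFrom3 m ++ ys) (suc (l + i)) ≡ at ys (suc i))
  (length-oddsFrom3 m) (at-++ʳ (oddsFrom3 m) ys i)

evens-past : ∀ m ys x i → x ≡ m + i → at (evensDownTo4 m ++ ys) (suc x) ≡ at ys (suc i)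
evens-past m ys _ i refl = subst (λ l → at (evensDownTo4 m ++ ys) (suc (l + i)) ≡ at ys (suc i))
  (length-evensDownTo4 m) (at-++ʳ (evensDownTo4 m) ys i)

ρ̂ μ̂ : ∀ k → Fin (2 * k) → ℕ
ρ̂ k Y = ρ* k (suc (toℕ Y))
μ̂ k Y = μ* k (suc (toℕ Y))

-- Labels for the positions 1 … n of ρ*_n and μ*_n, n = 2(r + 4) = 2r + 8.
-- The one-line notations split into blocks, and a label names a position
-- by its block (the names refer to the shape of the crossing graph,
-- see CrossingGraph).  Values of both permutations at the position:
--
--   label      position     ρ*        μ*
--   leaf₁      1            1         2
--   leaf₂      2            2         3
--   odd t      t + 3        2t + 3    2t + 5      (t ≤ r)
--   apex       r + 4        n - 3     n
--   top₁       r + 5        n - 1     n - 1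
--   top₂       r + 6        n         n - 2
--   even s d   r + 7 + d    2s + 6    2s + 4      (s + d = r)
--   hub        n            4         1
data Label : Set where
  leaf₁ leaf₂ apex top₁ top₂ hub : Label
  odd  : ℕ → Label
  even : ℕ → ℕ → Label

module Profile (r : ℕ) where
  open ≡-Reasoning

  K : ℕ
  K = 4 + r

  2K≡ : 2 * K ≡ 8 + double r
  2K≡ = 2*≡double K

  Valid : Label → Set
  Valid (odd t)    = t ≤ r
  Valid (even s d) = s + d ≡ r
  Valid _          = ⊤

  pos : Label → ℕ
  pos leaf₁      = 1
  pos leaf₂      = 2
  pos (odd t)    = 3 + t
  pos apex       = 4 + r
  pos top₁       = 5 + r
  pos top₂       = 6 + r
  pos (even s d) = 7 + d + r
  pos hub        = 8 + double r

  ρL : Label → ℕ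
  ρL leaf₁      = 1
  ρL leaf₂      = 2
  ρL (odd t)    = 3 + double t
  ρL apex       = 5 + double r
  ρL top₁       = 7 + double r
  ρL top₂       = 8 + double r
  ρL (even s d) = 6 + double s
  ρL hub        = 4

  μL : Label → ℕ
  μL leaf₁      = 2
  μL leaf₂      = 3
  μL (odd t)    = 5 + double t
  μL apex       = 8 + double r
  μL top₁       = 7 + double r
  μL top₂       = 6 + double r
  μL (even s d) = 4 + double s
  μL hub        = 1

  ρ-tail μ-tail : List ℕ
  ρ-tail = 2 * K ∷ evensDownTo4 (2 + r)
  μ-tail = 2 * K ∷ (2 * K ∸ 1) ∷ (evensDownTo4 (2 + r) ++ 1 ∷ [])

  ρ*-pos : ∀ v → Valid v → ρ* K (pos v) ≡ ρL v
  ρ*-pos leaf₁      _    = refl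
  ρ*-pos leaf₂      _    = refl
  ρ*-pos (odd t)    t≤r  = odds-at (3 + r) ρ-tail t (s≤s (≤-trans t≤r (m≤n+m r 2)))
  ρ*-pos apex       _    = odds-at (3 + r) ρ-tail (suc r) (s≤s (s≤s (n≤1+n _)))
  ρ*-pos top₁       _    = odds-at (3 + r) ρ-tail (suc (suc r)) ≤-refl
  ρ*-pos top₂       _    = trans (odds-past (3 + r) ρ-tail (3 + r) 0 (sym (+-identityʳ _))) 2K≡
  ρ*-pos (even s d) refl = begin
    at (oddsFrom3 (3 + s + d) ++ ρ-tail) (suc (4 + d + (s + d)))
      ≡⟨ odds-past (3 + s + d) ρ-tail _ (suc d) (trans (cong (4 +_) (+-comm d (s + d))) (sym (+-suc (3 + (s + d)) d))) ⟩
    at (evensDownTo4 (2 + s + d)) (suc d)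
      ≡⟨ evens-at (2 + s + d) d (s≤s (≤-trans (m≤n+m d s) (n≤1+n _))) ⟩
    4 + double (suc (s + d) ∸ d)
      ≡⟨ cong (λ x → 4 + double x) (m+n∸n≡m (suc s) d) ⟩
    6 + double s ∎
  ρ*-pos hub        _    = begin
    at (oddsFrom3 (3 + r) ++ ρ-tail) (suc (5 + double r))
      ≡⟨ odds-past (3 + r) ρ-tail (5 + double r) (suc (suc r)) (trans (cong (5 +_) (sym (2*≡double r))) (solve (r ∷ []))) ⟩
    at (evensDownTo4 (2 + r)) (suc (suc r))
      ≡⟨ evens-at (2 + r) (suc r) ≤-refl ⟩
    4 + double (r ∸ r)
      ≡⟨ cong (λ x → 4 + double x) (n∸n≡0 r) ⟩
    4 ∎

  μ*-pos : ∀ v → Valid v → μ* K (pos v) ≡ μL v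
  μ*-pos leaf₁      _    = refl
  μ*-pos leaf₂      _    = odds-at (2 + r) μ-tail 0 (s≤s z≤n)
  μ*-pos (odd t)    t≤r  = odds-at (2 + r) μ-tail (suc t) (s≤s (s≤s t≤r))
  μ*-pos apex       _    = trans (odds-past (2 + r) μ-tail (2 + r) 0 (sym (+-identityʳ _))) 2K≡
  μ*-pos top₁       _    = trans (odds-past (2 + r) μ-tail (3 + r) 1 (sym (+-comm (2 + r) 1))) (cong (_∸ 1) 2K≡)
  μ*-pos top₂       _    = begin
    at (oddsFrom3 (2 + r) ++ μ-tail) (suc (4 + r))
      ≡⟨ odds-past (2 + r) μ-tail (4 + r) 2 (sym (+-comm (2 + r) 2)) ⟩
    at (evensDownTo4 (2 + r) ++ 1 ∷ []) 1
      ≡⟨ evens-at-++ (2 + r) (1 ∷ []) 0 (s≤s z≤n) ⟩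
    6 + double r ∎
  μ*-pos (even s d) refl = begin
    at (oddsFrom3 (2 + s + d) ++ μ-tail) (suc (5 + d + (s + d)))
      ≡⟨ odds-past (2 + s + d) μ-tail (5 + d + (s + d)) (3 + d) (solve (s ∷ d ∷ [])) ⟩
    at (evensDownTo4 (2 + s + d) ++ 1 ∷ []) (suc (suc d))
      ≡⟨ evens-at-++ (2 + s + d) (1 ∷ []) (suc d) (s≤s (s≤s (m≤n+m d s))) ⟩
    4 + double (s + d ∸ d)
      ≡⟨ cong (λ x → 4 + double x) (m+n∸n≡m s d) ⟩
    4 + double s ∎
  μ*-pos hub        _    = begin
    at (oddsFrom3 (2 + r) ++ μ-tail) (suc (6 + double r))
      ≡⟨ odds-past (2 + r) μ-tail (6 + double r) (4 + r) (trans (cong (6 +_) (sym (2*≡double r))) (solve (r ∷ []))) ⟩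
    at (evensDownTo4 (2 + r) ++ 1 ∷ []) (suc (2 + r))
      ≡⟨ evens-past (2 + r) (1 ∷ []) _ 0 (sym (+-identityʳ _)) ⟩
    1 ∎

  InRange : ℕ → Set
  InRange x = 1 ≤ x × x ≤ 8 + double r

  in-range : ∀ m {x} {_ : T (1 ≤ᵇ m)} {_ : T (m ≤ᵇ 8)} → x ≤ double r → InRange (m + x)
  in-range m {x} {p} {q} x≤2r = ≤-trans (≤ᵇ⇒≤ 1 m p) (m≤m+n m x) , +-mono-≤ (≤ᵇ⇒≤ m 8 q) x≤2r

  label-in-range : ∀ v → Valid v → InRange (pos v) × InRange (ρL v) × InRange (μL v)
  label-in-range leaf₁      _    = in-range 1 z≤n , in-range 1 z≤n , in-range 2 z≤n
  label-in-range leaf₂      _    = in-range 2 z≤n , in-range 2 z≤n , in-range 3 z≤n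
  label-in-range (odd t)    t≤r  =
    in-range 3 (≤-trans t≤r (n≤double r)) , in-range 3 (double-mono-≤ t≤r) , in-range 5 (double-mono-≤ t≤r)
  label-in-range apex       _    = in-range 4 (n≤double r) , in-range 5 ≤-refl , in-range 8 ≤-refl
  label-in-range top₁       _    = in-range 5 (n≤double r) , in-range 7 ≤-refl , in-range 7 ≤-refl
  label-in-range top₂       _    = in-range 6 (n≤double r) , in-range 8 ≤-refl , in-range 6 ≤-refl
  label-in-range (even s d) refl =
    in-range 7 (≤-trans (+-monoˡ-≤ (s + d) (m≤n+m d s)) (≤-reflexive (+≡double (s + d)))) ,
    in-range 6 (double-mono-≤ (m≤m+n s d)) , in-range 4 (double-mono-≤ (m≤m+n s d))
  label-in-range hub        _    = in-range 8 ≤-refl , in-range 4 z≤n , in-range 1 z≤n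

  Labelled : ℕ → Set
  Labelled x = Σ Label λ v → Valid v × pos v ≡ x

  labelled-tail : ∀ z → z ≤ 4 + r → Labelled (4 + z + r)
  labelled-tail 0 _ = apex , tt , refl
  labelled-tail 1 _ = top₁ , tt , refl
  labelled-tail 2 _ = top₂ , tt , refl
  labelled-tail (suc (suc (suc d))) (s≤s (s≤s (s≤s d≤1+r))) with d ≤? r
  ... | yes d≤r = even (r ∸ d) d , m∸n+n≡m d≤r , refl
  ... | no  d≰r with ≤-antisym d≤1+r (≰⇒> d≰r)
  ...   | refl = hub , tt , cong (8 +_) (sym (+≡double r))

  labelled : ∀ y → y < 8 + double r → Labelled (suc y)
  labelled 0 _ = leaf₁ , tt , refl
  labelled 1 _ = leaf₂ , tt , refl
  labelled (suc (suc t)) (s≤s (s≤s (s≤s t≤5+2r))) with t ≤? r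
  ... | yes t≤r = odd t , t≤r , refl
  ... | no  t≰r = subst Labelled (cong (3 +_) (trans (sym (+-suc z r)) (m∸n+n≡m (≰⇒> t≰r))))
                        (labelled-tail z (m≤n+o⇒m∸n≤o t (suc r) (subst (t ≤_) (sym 5+2r≡) t≤5+2r)))
    where
    z : ℕ
    z = t ∸ suc r
    5+2r≡ : suc r + (4 + r) ≡ 5 + double r
    5+2r≡ = trans (cong suc (+-comm r (4 + r))) (cong (5 +_) (+≡double r))

  index : ∀ x → InRange x → Fin (2 * K)
  index (suc y) (_ , x≤n) = fromℕ< (subst (suc y ≤_) (sym 2K≡) x≤n)

  index-pos : ∀ x (p : InRange x) → suc (toℕ (index x p)) ≡ x
  index-pos (suc y) (_ , x≤n) = cong suc (toℕ-fromℕ< _)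

  positionOf : ∀ v → Valid v → Fin (2 * K)
  positionOf v vv = index (pos v) (proj₁ (label-in-range v vv))

  positionOf-pos : ∀ v vv → suc (toℕ (positionOf v vv)) ≡ pos v
  positionOf-pos v vv = index-pos (pos v) (proj₁ (label-in-range v vv))

  labelAt : Fin (2 * K) → Label
  labelAt Y = proj₁ (labelled (toℕ Y) (subst (toℕ Y <_) 2K≡ (toℕ<n Y)))

  labelAt-valid : ∀ Y → Valid (labelAt Y)
  labelAt-valid Y = proj₁ (proj₂ (labelled (toℕ Y) (subst (toℕ Y <_) 2K≡ (toℕ<n Y))))

  pos-labelAt : ∀ Y → pos (labelAt Y) ≡ suc (toℕ Y)
  pos-labelAt Y = proj₂ (proj₂ (labelled (toℕ Y) (subst (toℕ Y <_) 2K≡ (toℕ<n Y))))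

  labelAt-injective : ∀ {Y Y′} → labelAt Y ≡ labelAt Y′ → Y ≡ Y′
  labelAt-injective {Y} {Y′} e =
    toℕ-injective (suc-injective (trans (sym (pos-labelAt Y)) (trans (cong pos e) (pos-labelAt Y′))))

  ρ̂-labelAt : ∀ Y → ρ̂ K Y ≡ ρL (labelAt Y)
  ρ̂-labelAt Y = trans (cong (ρ* K) (sym (pos-labelAt Y))) (ρ*-pos _ (labelAt-valid Y))

  μ̂-labelAt : ∀ Y → μ̂ K Y ≡ μL (labelAt Y)
  μ̂-labelAt Y = trans (cong (μ* K) (sym (pos-labelAt Y))) (μ*-pos _ (labelAt-valid Y))

  ρ̂-positionOf : ∀ v vv → ρ̂ K (positionOf v vv) ≡ ρL v
  ρ̂-positionOf v vv = trans (cong (ρ* K) (positionOf-pos v vv)) (ρ*-pos v vv)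

  μ̂-positionOf : ∀ v vv → μ̂ K (positionOf v vv) ≡ μL v
  μ̂-positionOf v vv = trans (cong (μ* K) (positionOf-pos v vv)) (μ*-pos v vv)

  ρL-in-range : ∀ v → Valid v → InRange (ρL v)
  ρL-in-range v vv = proj₁ (proj₂ (label-in-range v vv))

  μL-in-range : ∀ v → Valid v → InRange (μL v)
  μL-in-range v vv = proj₂ (proj₂ (label-in-range v vv))

  even-s≤r : ∀ {s d} → s + d ≡ r → s ≤ r
  even-s≤r {s} {d} refl = m≤m+n s d

module CrossingGraph (r : ℕ) where
  open Profile r

  Crosses : Label → Label → Set
  Crosses u v = ρL u < ρL v × μL v < μL u

  -- The crossing pairs, listed with the smaller ρ-value first.  The graph
  -- is the path  hub – odd 0 – even 0 r – odd 1 – … – odd r – even r 0 – apex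
  -- with two leaves leaf₁, leaf₂ at hub and a triangle apex, top₁, top₂.
  data Edge : Label → Label → Set where
    leaf₁-hub : Edge leaf₁ hub
    leaf₂-hub : Edge leaf₂ hub
    odd-hub   : Edge (odd 0) hub
    odd-even  : ∀ s d → Edge (odd s) (even s d)
    odd-even′ : ∀ s d → Edge (odd (suc s)) (even s d)
    apex-even : Edge apex (even r 0)
    apex-top₁ : Edge apex top₁
    apex-top₂ : Edge apex top₂
    top₁-top₂ : Edge top₁ top₂

  edge⇒crosses : ∀ {u v} → Edge u v → Crosses u v
  edge⇒crosses leaf₁-hub       = <ᵇ⇒< 1 4 _ , <ᵇ⇒< 1 2 _
  edge⇒crosses leaf₂-hub       = <ᵇ⇒< 2 4 _ , <ᵇ⇒< 1 3 _
  edge⇒crosses odd-hub         = <ᵇ⇒< 3 4 _ , <ᵇ⇒< 1 5 _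
  edge⇒crosses (odd-even s d)  = +-monoˡ-< (double s) (<ᵇ⇒< 3 6 _) , +-monoˡ-< (double s) (<ᵇ⇒< 4 5 _)
  edge⇒crosses (odd-even′ s d) = +-monoˡ-< (double s) (<ᵇ⇒< 5 6 _) , +-monoˡ-< (double s) (<ᵇ⇒< 4 7 _)
  edge⇒crosses apex-even       = +-monoˡ-< (double r) (<ᵇ⇒< 5 6 _) , +-monoˡ-< (double r) (<ᵇ⇒< 4 8 _)
  edge⇒crosses apex-top₁       = +-monoˡ-< (double r) (<ᵇ⇒< 5 7 _) , +-monoˡ-< (double r) (<ᵇ⇒< 7 8 _)
  edge⇒crosses apex-top₂       = +-monoˡ-< (double r) (<ᵇ⇒< 5 8 _) , +-monoˡ-< (double r) (<ᵇ⇒< 6 8 _)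
  edge⇒crosses top₁-top₂       = +-monoˡ-< (double r) (<ᵇ⇒< 7 8 _) , +-monoˡ-< (double r) (<ᵇ⇒< 6 7 _)

  from-leaf₁ : ∀ v → Crosses leaf₁ v → Edge leaf₁ v
  from-leaf₁ hub        _                   = leaf₁-hub
  from-leaf₁ leaf₁      (s≤s () , _)
  from-leaf₁ leaf₂      (_ , s≤s (s≤s ()))
  from-leaf₁ (odd _)    (_ , s≤s (s≤s ()))
  from-leaf₁ apex       (_ , s≤s (s≤s ()))
  from-leaf₁ top₁       (_ , s≤s (s≤s ()))
  from-leaf₁ top₂       (_ , s≤s (s≤s ()))
  from-leaf₁ (even _ _) (_ , s≤s (s≤s ()))

  from-leaf₂ : ∀ v → Crosses leaf₂ v → Edge leaf₂ v
  from-leaf₂ hub        _                         = leaf₂-hub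
  from-leaf₂ leaf₁      (s≤s () , _)
  from-leaf₂ leaf₂      (s≤s (s≤s ()) , _)
  from-leaf₂ (odd _)    (_ , s≤s (s≤s (s≤s ())))
  from-leaf₂ apex       (_ , s≤s (s≤s (s≤s ())))
  from-leaf₂ top₁       (_ , s≤s (s≤s (s≤s ())))
  from-leaf₂ top₂       (_ , s≤s (s≤s (s≤s ())))
  from-leaf₂ (even _ _) (_ , s≤s (s≤s (s≤s ())))

  from-odd : ∀ {t} v → t ≤ r → Crosses (odd t) v → Edge (odd t) v
  from-odd leaf₁      _   (s≤s () , _)
  from-odd leaf₂      _   (s≤s (s≤s ()) , _)
  from-odd (odd _)    _   (s≤s (s≤s (s≤s ρ<)) , s≤s (s≤s (s≤s (s≤s (s≤s μ<))))) =
    ⊥-elim (<-asym (double-cancel-< ρ<) (double-cancel-< μ<))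
  from-odd apex       t≤r (_ , μ<) = ⊥-elim (beyond 8 5 t≤r μ<)
  from-odd top₁       t≤r (_ , μ<) = ⊥-elim (beyond 7 5 t≤r μ<)
  from-odd top₂       t≤r (_ , μ<) = ⊥-elim (beyond 6 5 t≤r μ<)
  from-odd (even s d) _   (s≤s (s≤s (s≤s (s≤s ρ<))) , s≤s (s≤s (s≤s (s≤s (s≤s μ<)))))
    with between (double-cancel-≤ μ<) (double-cancel-≤ ρ<)
  ... | inj₁ refl = odd-even s d
  ... | inj₂ refl = odd-even′ s d
  from-odd {zero}  hub _ _ = odd-hub
  from-odd {suc _} hub _ (s≤s (s≤s (s≤s (s≤s ()))) , _)

  apex-even-only : ∀ s d → s + d ≡ r → r ≤ s → Edge apex (even s d)
  apex-even-only s zero    s+0≡r _   = subst (λ x → Edge apex (even x 0)) (trans (sym s+0≡r) (+-identityʳ s)) apex-even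
  apex-even-only s (suc d) s+d≡r r≤s = ⊥-elim (<⇒≱ (m<m+n s (s≤s z≤n)) (subst (_≤ s) (sym s+d≡r) r≤s))

  from-apex : ∀ v → Valid v → Crosses apex v → Edge apex v
  from-apex leaf₁      _   (s≤s () , _)
  from-apex leaf₂      _   (s≤s (s≤s ()) , _)
  from-apex (odd _)    t≤r (ρ< , _) = ⊥-elim (beyond 5 3 t≤r ρ<)
  from-apex apex       _   (ρ< , _) = ⊥-elim (<-irrefl refl ρ<)
  from-apex top₁       _   _        = apex-top₁
  from-apex top₂       _   _        = apex-top₂
  from-apex (even s d) s+d≡r (s≤s (s≤s (s≤s (s≤s (s≤s (s≤s ρ<))))) , _) =
    apex-even-only s d s+d≡r (double-cancel-≤ ρ<)
  from-apex hub        _   (s≤s (s≤s (s≤s (s≤s ()))) , _)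

  from-top₁ : ∀ v → Valid v → Crosses top₁ v → Edge top₁ v
  from-top₁ leaf₁      _     (s≤s () , _)
  from-top₁ leaf₂      _     (s≤s (s≤s ()) , _)
  from-top₁ (odd _)    t≤r   (ρ< , _) = ⊥-elim (beyond 7 3 t≤r ρ<)
  from-top₁ apex       _     (ρ< , _) = ⊥-elim (beyond 7 5 ≤-refl ρ<)
  from-top₁ top₁       _     (ρ< , _) = ⊥-elim (<-irrefl refl ρ<)
  from-top₁ top₂       _     _        = top₁-top₂
  from-top₁ (even _ _) s+d≡r (ρ< , _) = ⊥-elim (beyond 7 6 (even-s≤r s+d≡r) ρ<)
  from-top₁ hub        _     (s≤s (s≤s (s≤s (s≤s ()))) , _)

  from-even : ∀ {s d} v → s ≤ r → ¬ Crosses (even s d) v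
  from-even leaf₁      _   (s≤s () , _)
  from-even leaf₂      _   (s≤s (s≤s ()) , _)
  from-even (odd t)    _   (s≤s (s≤s (s≤s ρ<)) , s≤s (s≤s (s≤s (s≤s μ<)))) =
    <⇒≱ (double-cancel-≤ μ<) (≤-trans (n≤1+n _) (≤-trans (n≤1+n _) (double-cancel-≤ ρ<)))
  from-even apex       s≤r (_ , μ<) = beyond 8 4 s≤r μ<
  from-even top₁       s≤r (_ , μ<) = beyond 7 4 s≤r μ<
  from-even top₂       s≤r (_ , μ<) = beyond 6 4 s≤r μ<
  from-even (even _ _) _   (s≤s (s≤s (s≤s (s≤s (s≤s (s≤s ρ<))))) , s≤s (s≤s (s≤s (s≤s μ<)))) =
    <-asym (double-cancel-< ρ<) (double-cancel-< μ<)
  from-even hub        _   (s≤s (s≤s (s≤s (s≤s ()))) , _)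

  crosses⇒edge : ∀ u v → Valid u → Valid v → Crosses u v → Edge u v
  crosses⇒edge leaf₁      v _     _  uv       = from-leaf₁ v uv
  crosses⇒edge leaf₂      v _     _  uv       = from-leaf₂ v uv
  crosses⇒edge (odd _)    v t≤r   _  uv       = from-odd v t≤r uv
  crosses⇒edge apex       v _     vv uv       = from-apex v vv uv
  crosses⇒edge top₁       v _     vv uv       = from-top₁ v vv uv
  crosses⇒edge top₂       v _     vv (ρ< , _) = ⊥-elim (<⇒≱ ρ< (proj₂ (ρL-in-range v vv)))
  crosses⇒edge (even _ d) v s+d≡r _  uv       = ⊥-elim (from-even {d = d} v (even-s≤r s+d≡r) uv)
  crosses⇒edge hub        v _     vv (_ , μ<) = ⊥-elim (<⇒≱ μ< (proj₁ (μL-in-range v vv)))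

  Adjacent : Label → Label → Set
  Adjacent u v = Edge u v ⊎ Edge v u

  adjacent-sym : ∀ {u v} → Adjacent u v → Adjacent v u
  adjacent-sym = swap

  adjacent⇒≢ : ∀ {u v} → Adjacent u v → u ≢ v
  adjacent⇒≢ (inj₁ uv) refl = <-irrefl refl (proj₁ (edge⇒crosses uv))
  adjacent⇒≢ (inj₂ vu) refl = <-irrefl refl (proj₁ (edge⇒crosses vu))

  incomparable⇒adjacent : ∀ u v → Valid u → Valid v →
    ρL v < ρL u ⊎ μL v < μL u → ρL u < ρL v ⊎ μL u < μL v → Adjacent u v
  incomparable⇒adjacent u v uu vv v≱u u≱v with incomparable⇒crossing v≱u u≱v
  ... | inj₁ uv = inj₁ (crosses⇒edge u v uu vv uv)
  ... | inj₂ vu = inj₂ (crosses⇒edge v u vv uu vu)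

  -- Distance from the leaves: it changes by at most one along an edge.
  depth : Label → ℕ
  depth leaf₁      = 0
  depth leaf₂      = 0
  depth hub        = 1
  depth (odd t)    = 2 + double t
  depth (even s d) = 3 + double s
  depth apex       = 4 + double r
  depth top₁       = 5 + double r
  depth top₂       = 5 + double r

  depth-edge : ∀ {u v} → Edge u v → depth u ≤ suc (depth v) × depth v ≤ suc (depth u)
  depth-edge leaf₁-hub       = z≤n , s≤s z≤n
  depth-edge leaf₂-hub       = z≤n , s≤s z≤n
  depth-edge odd-hub         = ≤-refl , s≤s z≤n
  depth-edge (odd-even s d)  = ≤-trans (n≤1+n _) (n≤1+n _) , ≤-refl
  depth-edge (odd-even′ s d) = ≤-refl , ≤-trans (n≤1+n _) (n≤1+n _)
  depth-edge apex-even       = ≤-refl , ≤-trans (n≤1+n _) (n≤1+n _)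
  depth-edge apex-top₁       = ≤-trans (n≤1+n _) (n≤1+n _) , ≤-refl
  depth-edge apex-top₂       = ≤-trans (n≤1+n _) (n≤1+n _) , ≤-refl
  depth-edge top₁-top₂       = n≤1+n _ , n≤1+n _

  depth-lipschitz : ∀ {u v} → Adjacent u v → depth v ≤ suc (depth u)
  depth-lipschitz (inj₁ uv) = proj₂ (depth-edge uv)
  depth-lipschitz (inj₂ vu) = proj₁ (depth-edge vu)

  AtMostTwoNeighbours : Label → Set
  AtMostTwoNeighbours w = Σ Label λ x → Σ Label λ y → ∀ u → Valid u → Adjacent w u → u ≡ x ⊎ u ≡ y

  even-valid : ∀ {s d} → s + d ≡ r → even s d ≡ even s (r ∸ s)
  even-valid {s} {d} refl = cong (even s) (sym (m+n∸m≡n s d))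

  few-neighbours : ∀ w → w ≡ hub ⊎ w ≡ apex ⊎ AtMostTwoNeighbours w
  few-neighbours hub         = inj₁ refl
  few-neighbours apex        = inj₂ (inj₁ refl)
  few-neighbours leaf₁       = inj₂ (inj₂ (hub , hub , λ { _ _ (inj₁ leaf₁-hub) → inj₁ refl }))
  few-neighbours leaf₂       = inj₂ (inj₂ (hub , hub , λ { _ _ (inj₁ leaf₂-hub) → inj₁ refl }))
  few-neighbours top₁        = inj₂ (inj₂ (top₂ , apex ,
    λ { _ _ (inj₁ top₁-top₂) → inj₁ refl ; _ _ (inj₂ apex-top₁) → inj₂ refl }))
  few-neighbours top₂        = inj₂ (inj₂ (apex , top₁ ,
    λ { _ _ (inj₂ apex-top₂) → inj₁ refl ; _ _ (inj₂ top₁-top₂) → inj₂ refl }))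
  few-neighbours (odd zero)  = inj₂ (inj₂ (hub , even 0 r ,
    λ { _ _ (inj₁ odd-hub) → inj₁ refl ; _ vv (inj₁ (odd-even _ _)) → inj₂ (even-valid vv) }))
  few-neighbours (odd (suc t)) = inj₂ (inj₂ (even t (r ∸ t) , even (suc t) (r ∸ suc t) ,
    λ { _ vv (inj₁ (odd-even _ _)) → inj₂ (even-valid vv) ; _ vv (inj₁ (odd-even′ _ _)) → inj₁ (even-valid vv) }))
  few-neighbours (even s d) with s ≟ r
  ... | yes refl = inj₂ (inj₂ (odd s , apex ,
    λ { _ _ (inj₂ (odd-even _ _)) → inj₁ refl ; _ 1+s≤s (inj₂ (odd-even′ _ _)) → ⊥-elim (<-irrefl refl 1+s≤s)
      ; _ _ (inj₂ apex-even) → inj₂ refl }))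
  ... | no s≢r = inj₂ (inj₂ (odd s , odd (suc s) ,
    λ { _ _ (inj₂ (odd-even _ _)) → inj₁ refl ; _ _ (inj₂ (odd-even′ _ _)) → inj₂ refl
      ; _ _ (inj₂ apex-even) → ⊥-elim (s≢r refl) }))

  degree-three : ∀ w {u₁ u₂ u₃} → Valid u₁ → Valid u₂ → Valid u₃ →
    Adjacent w u₁ → Adjacent w u₂ → Adjacent w u₃ → u₁ ≢ u₂ → u₁ ≢ u₃ → u₂ ≢ u₃ → w ≡ hub ⊎ w ≡ apex
  degree-three w {u₁} {u₂} {u₃} v₁ v₂ v₃ a₁ a₂ a₃ u₁≢u₂ u₁≢u₃ u₂≢u₃ with few-neighbours w
  ... | inj₁ w≡hub                 = inj₁ w≡hub
  ... | inj₂ (inj₁ w≡apex)         = inj₂ w≡apex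
  ... | inj₂ (inj₂ (_ , _ , only)) =
    ⊥-elim (pigeonhole (only u₁ v₁ a₁) (only u₂ v₂ a₂) (only u₃ v₃ a₃) u₁≢u₂ u₁≢u₃ u₂≢u₃)

  -- The only triangle is apex, top₁, top₂: away from top₁ and top₂ the
  -- graph is bipartite, and the neighbours of top₁, top₂ lie in the triangle.
  IsTop : Label → Set
  IsTop x = x ≡ top₁ ⊎ x ≡ top₂

  InTriangle : Label → Set
  InTriangle x = x ≡ apex ⊎ IsTop x

  colour : Label → Bool
  colour hub        = false
  colour (even _ _) = false
  colour _          = true

  edge-colours : ∀ {x y} → Edge x y → IsTop x ⊎ IsTop y ⊎ colour x ≢ colour y
  edge-colours leaf₁-hub       = inj₂ (inj₂ λ ())
  edge-colours leaf₂-hub       = inj₂ (inj₂ λ ())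
  edge-colours odd-hub         = inj₂ (inj₂ λ ())
  edge-colours (odd-even _ _)  = inj₂ (inj₂ λ ())
  edge-colours (odd-even′ _ _) = inj₂ (inj₂ λ ())
  edge-colours apex-even       = inj₂ (inj₂ λ ())
  edge-colours apex-top₁       = inj₂ (inj₁ (inj₁ refl))
  edge-colours apex-top₂       = inj₂ (inj₁ (inj₂ refl))
  edge-colours top₁-top₂       = inj₁ (inj₁ refl)

  adjacent-colours : ∀ {x y} → Adjacent x y → IsTop x ⊎ IsTop y ⊎ colour x ≢ colour y
  adjacent-colours (inj₁ xy) = edge-colours xy
  adjacent-colours (inj₂ yx) with edge-colours yx
  ... | inj₁ top-y          = inj₂ (inj₁ top-y)
  ... | inj₂ (inj₁ top-x)   = inj₁ top-x
  ... | inj₂ (inj₂ yx-diff) = inj₂ (inj₂ (yx-diff ∘ sym))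

  top-neighbour : ∀ {x y} → IsTop x → Adjacent x y → InTriangle y
  top-neighbour (inj₁ refl) (inj₁ top₁-top₂) = inj₂ (inj₂ refl)
  top-neighbour (inj₁ refl) (inj₂ apex-top₁) = inj₁ refl
  top-neighbour (inj₂ refl) (inj₂ apex-top₂) = inj₁ refl
  top-neighbour (inj₂ refl) (inj₂ top₁-top₂) = inj₂ (inj₁ refl)

  triangle : ∀ {u v w} → Adjacent u v → Adjacent v w → Adjacent u w →
             InTriangle u × InTriangle v × InTriangle w
  triangle uv vw uw with adjacent-colours uv | adjacent-colours vw | adjacent-colours uw
  ... | inj₁ top-u        | _                 | _ = inj₂ top-u , top-neighbour top-u uv , top-neighbour top-u uw
  ... | inj₂ (inj₁ top-v) | _                 | _ =
    top-neighbour top-v (adjacent-sym uv) , inj₂ top-v , top-neighbour top-v vw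
  ... | _                 | inj₂ (inj₁ top-w) | _ =
    top-neighbour top-w (adjacent-sym uw) , top-neighbour top-w (adjacent-sym vw) , inj₂ top-w
  ... | _                 | inj₁ top-v        | _ =
    top-neighbour top-v (adjacent-sym uv) , inj₂ top-v , top-neighbour top-v vw
  ... | _                 | _                 | inj₁ top-u =
    inj₂ top-u , top-neighbour top-u uv , top-neighbour top-u uw
  ... | _                 | _                 | inj₂ (inj₁ top-w) =
    top-neighbour top-w (adjacent-sym uw) , top-neighbour top-w (adjacent-sym vw) , inj₂ top-w
  ... | inj₂ (inj₂ uv-diff) | inj₂ (inj₂ vw-diff) | inj₂ (inj₂ uw-diff) = ⊥-elim (two-colours uv-diff vw-diff uw-diff)

  triangle-apex : ∀ {u v w} → Adjacent u v → Adjacent v w → Adjacent u w → u ≡ apex ⊎ v ≡ apex ⊎ w ≡ apex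
  triangle-apex uv vw uw with triangle uv vw uw
  ... | inj₁ u≡apex , _            , _            = inj₁ u≡apex
  ... | _           , inj₁ v≡apex  , _            = inj₂ (inj₁ v≡apex)
  ... | _           , _            , inj₁ w≡apex  = inj₂ (inj₂ w≡apex)
  ... | inj₂ top-u  , inj₂ top-v   , inj₂ top-w   =
    ⊥-elim (pigeonhole top-u top-v top-w (adjacent⇒≢ uv) (adjacent⇒≢ uw) (adjacent⇒≢ vw))

  triangle-depth : ∀ {x} → InTriangle x → 4 + double r ≤ depth x
  triangle-depth (inj₁ refl)        = ≤-refl
  triangle-depth (inj₂ (inj₁ refl)) = n≤1+n _
  triangle-depth (inj₂ (inj₂ refl)) = n≤1+n _

-- The triangle
-- goes to the triangle, and hub (three neighbours) goes to hub.  The path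
-- hub – odd 0 – even 0 – … – odd q – even q 0 – apex has 2q + 3 edges and
-- depth changes by at most one per edge, so the image of apex has depth at
-- most 4 + 2q; lying in the triangle, it has depth at least 4 + 2r.
module Rigidity (q r : ℕ)
  (H : ∀ v → Profile.Valid q v → Label)
  (H-valid : ∀ v vv → Profile.Valid r (H v vv))
  (H-injective : ∀ u v uu vv → H u uu ≡ H v vv → Profile.pos q u ≡ Profile.pos q v)
  (H-adjacent : ∀ {u v} uu vv → CrossingGraph.Edge q u v → CrossingGraph.Adjacent r (H u uu) (H v vv))
  where
  open Profile q using (pos)
  open CrossingGraph q using (leaf₁-hub; leaf₂-hub; odd-hub; odd-even; odd-even′; apex-even; apex-top₁; apex-top₂; top₁-top₂)
  open CrossingGraph r using (InTriangle; adjacent-sym; depth; depth-lipschitz; degree-three; triangle; triangle-apex; triangle-depth)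

  H-distinct : ∀ u v uu vv → pos u ≢ pos v → H u uu ≢ H v vv
  H-distinct u v uu vv pu≢pv = pu≢pv ∘ H-injective u v uu vv

  -- hub comes after apex, top₁ and top₂
  hub≢triangle : ∀ m {_ : T (m <ᵇ 8)} → 8 + double q ≢ m + q
  hub≢triangle m {m<8} = ≢-sym (<⇒≢ (+-mono-<-≤ (<ᵇ⇒< m 8 m<8) (n≤double q)))

  apex↦triangle : InTriangle (H apex tt)
  apex↦triangle = proj₁ (triangle (H-adjacent tt tt apex-top₁) (H-adjacent tt tt top₁-top₂) (H-adjacent tt tt apex-top₂))

  hub↦hub : H hub tt ≡ hub
  hub↦hub with degree-three (H hub tt) (H-valid leaf₁ tt) (H-valid leaf₂ tt) (H-valid (odd 0) z≤n)
                 (adjacent-sym (H-adjacent tt tt leaf₁-hub)) (adjacent-sym (H-adjacent tt tt leaf₂-hub))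
                 (adjacent-sym (H-adjacent z≤n tt odd-hub))
                 (H-distinct leaf₁ leaf₂ tt tt λ ()) (H-distinct leaf₁ (odd 0) tt z≤n λ ())
                 (H-distinct leaf₂ (odd 0) tt z≤n λ ())
  ... | inj₁ hub↦hub′ = hub↦hub′
  ... | inj₂ hub↦apex with triangle-apex (H-adjacent tt tt apex-top₁) (H-adjacent tt tt top₁-top₂) (H-adjacent tt tt apex-top₂)
  ...   | inj₁ apex↦apex        = ⊥-elim (H-distinct hub apex tt tt (hub≢triangle 4) (trans hub↦apex (sym apex↦apex)))
  ...   | inj₂ (inj₁ top₁↦apex) = ⊥-elim (H-distinct hub top₁ tt tt (hub≢triangle 5) (trans hub↦apex (sym top₁↦apex)))
  ...   | inj₂ (inj₂ top₂↦apex) = ⊥-elim (H-distinct hub top₂ tt tt (hub≢triangle 6) (trans hub↦apex (sym top₂↦apex)))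

  depth-odd : ∀ t (t≤q : t ≤ q) → depth (H (odd t) t≤q) ≤ 2 + double t
  depth-odd zero    t≤q = subst (λ x → depth (H (odd 0) t≤q) ≤ suc (depth x)) hub↦hub
                                (depth-lipschitz (adjacent-sym (H-adjacent t≤q tt odd-hub)))
  depth-odd (suc t) t<q = begin
    depth (H (odd (suc t)) t<q)
      ≤⟨ depth-lipschitz (adjacent-sym (H-adjacent t<q valid (odd-even′ t (q ∸ t)))) ⟩
    suc (depth (H (even t (q ∸ t)) valid))
      ≤⟨ s≤s (depth-lipschitz (H-adjacent t≤q valid (odd-even t (q ∸ t)))) ⟩
    2 + depth (H (odd t) t≤q)
      ≤⟨ s≤s (s≤s (depth-odd t t≤q)) ⟩
    4 + double t ∎
    where
    open ≤-Reasoning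
    t≤q : t ≤ q
    t≤q = ≤-trans (n≤1+n t) t<q
    valid : t + (q ∸ t) ≡ q
    valid = m+[n∸m]≡n t≤q

  depth-apex : depth (H apex tt) ≤ 4 + double q
  depth-apex = begin
    depth (H apex tt)
      ≤⟨ depth-lipschitz (adjacent-sym (H-adjacent tt valid apex-even)) ⟩
    suc (depth (H (even q 0) valid))
      ≤⟨ s≤s (depth-lipschitz (H-adjacent ≤-refl valid (odd-even q 0))) ⟩
    2 + depth (H (odd q) ≤-refl)
      ≤⟨ s≤s (s≤s (depth-odd q ≤-refl)) ⟩
    4 + double q ∎
    where
    open ≤-Reasoning
    valid : q + 0 ≡ q
    valid = +-identityʳ q

  r≤q : r ≤ q
  r≤q = double-cancel-≤ (+-cancelˡ-≤ 4 _ _ (≤-trans (triangle-depth apex↦triangle) depth-apex))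

data Part : Set where
  A B C : Part

part : ∀ {n} → Vertex n → Part
part (a _) = A
part (b _) = B
part (c _) = C

A-or-C : ∀ {P} → P ≢ B → P ≡ A ⊎ P ≡ C
A-or-C {A} _   = inj₁ refl
A-or-C {B} P≢B = ⊥-elim (P≢B refl)
A-or-C {C} _   = inj₂ refl

B-neighbour : ∀ k (Z W : Vertex (2 * k)) → Adj k Z W → part Z ≡ B → part W ≢ B
B-neighbour k (b _) (a _) _ _ ()
B-neighbour k (b _) (c _) _ _ ()

non-B-neighbour : ∀ k (Z W : Vertex (2 * k)) → Adj k Z W → part Z ≢ B → Σ (Fin (2 * k)) λ Y → W ≡ b Y
non-B-neighbour k (a _) (b Y) _ _   = Y , refl
non-B-neighbour k (c _) (b Y) _ _   = Y , refl
non-B-neighbour k (b _) _     _ Z∉B = ⊥-elim (Z∉B refl)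

Separates : ∀ k → (W Z₁ Z₂ : Vertex (2 * k)) → Set
Separates k W Z₁ Z₂ = Adj k W Z₁ × ¬ Adj k W Z₂

MutuallySeparated : ∀ k → (Z₁ Z₂ : Vertex (2 * k)) → Set
MutuallySeparated k Z₁ Z₂ = (Σ (Vertex (2 * k)) λ W → Separates k W Z₁ Z₂) × (Σ (Vertex (2 * k)) λ W → Separates k W Z₂ Z₁)

module InducedEmbedding (j k : ℕ) (f : Vertex (2 * j) → Vertex (2 * k))
  (f-induced : ∀ u v → (Adj j u v → Adj k (f u) (f v)) × (Adj k (f u) (f v) → Adj j u v)) where

  preserves-separation : ∀ {W Z₁ Z₂} → Separates j W Z₁ Z₂ → Separates k (f W) (f Z₁) (f Z₂)
  preserves-separation {W} {Z₁} {Z₂} (adj , ¬adj) = proj₁ (f-induced W Z₁) adj , ¬adj ∘ proj₂ (f-induced W Z₂)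

  preserves-mutual-separation : ∀ {Z₁ Z₂} → MutuallySeparated j Z₁ Z₂ → MutuallySeparated k (f Z₁) (f Z₂)
  preserves-mutual-separation ((W₁ , s₁) , (W₂ , s₂)) = (f W₁ , preserves-separation s₁) , (f W₂ , preserves-separation s₂)

-- The neighbourhoods of the A-vertices are nested (a_x sees b_Y iff
-- x ≤ ρ̂ Y), so two A-vertices are never mutually separated; likewise for C.
A-nested : ∀ k {x x′} → ¬ MutuallySeparated k (a x) (a x′)
A-nested k ((b Y , x≤ρY , x′≰ρY) , (b Y′ , x′≤ρY′ , x≰ρY′)) =
  <-asym (≤-trans x≤ρY (≤-pred (≰⇒> x′≰ρY))) (≤-trans x′≤ρY′ (≤-pred (≰⇒> x≰ρY′)))
A-nested k ((a _ , () , _) , _)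
A-nested k ((c _ , () , _) , _)
A-nested k (_ , (a _ , () , _))
A-nested k (_ , (c _ , () , _))

C-nested : ∀ k {x x′} → ¬ MutuallySeparated k (c x) (c x′)
C-nested k ((b Y , x≤μY , x′≰μY) , (b Y′ , x′≤μY′ , x≰μY′)) =
  <-asym (≤-trans x≤μY (≤-pred (≰⇒> x′≰μY))) (≤-trans x′≤μY′ (≤-pred (≰⇒> x≰μY′)))
C-nested k ((a _ , () , _) , _)
C-nested k ((c _ , () , _) , _)
C-nested k (_ , (a _ , () , _))
C-nested k (_ , (c _ , () , _))

nested : ∀ k (Z₁ Z₂ : Vertex (2 * k)) → part Z₁ ≢ B → MutuallySeparated k Z₁ Z₂ → part Z₁ ≢ part Z₂
nested k (a _) (a _) _   sep _  = A-nested k sep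
nested k (c _) (c _) _   sep _  = C-nested k sep
nested k (b _) _     Z∉B _   _  = Z∉B refl
nested k (a _) (b _) _   _   ()
nested k (a _) (c _) _   _   ()
nested k (c _) (a _) _   _   ()
nested k (c _) (b _) _   _   ()

separates-B : ∀ k W Y₁ Y₂ → Separates k W (b Y₁) (b Y₂) → ρ̂ k Y₂ < ρ̂ k Y₁ ⊎ μ̂ k Y₂ < μ̂ k Y₁
separates-B k (a _) _ _ (adj , ¬adj) = inj₁ (≤-trans (≰⇒> ¬adj) adj)
separates-B k (c _) _ _ (adj , ¬adj) = inj₂ (≤-trans (≰⇒> ¬adj) adj)
separates-B k (b _) _ _ (() , _)

module SeparationOfB (r : ℕ) where
  open Profile r
  open CrossingGraph r

  mutually-separated⇒adjacent : ∀ Y₁ Y₂ → MutuallySeparated K (b Y₁) (b Y₂) → Adjacent (labelAt Y₁) (labelAt Y₂)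
  mutually-separated⇒adjacent Y₁ Y₂ ((W₁ , s₁) , (W₂ , s₂)) =
    incomparable⇒adjacent _ _ (labelAt-valid Y₁) (labelAt-valid Y₂) (relabel W₁ Y₁ Y₂ s₁) (relabel W₂ Y₂ Y₁ s₂)
    where
    relabel : ∀ W Y Y′ → Separates K W (b Y) (b Y′) → ρL (labelAt Y′) < ρL (labelAt Y) ⊎ μL (labelAt Y′) < μL (labelAt Y)
    relabel W Y Y′ s = Sum.map (subst₂ _<_ (ρ̂-labelAt Y′) (ρ̂-labelAt Y)) (subst₂ _<_ (μ̂-labelAt Y′) (μ̂-labelAt Y))
                               (separates-B K W Y Y′ s)

  -- c_{μ(u)} separates u from v, and a_{ρ(v)} separates v from u
  crosses⇒mutually-separated : ∀ u v uu vv → Crosses u v → MutuallySeparated K (b (positionOf u uu)) (b (positionOf v vv))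
  crosses⇒mutually-separated u v uu vv (ρu<ρv , μv<μu) = (c wc , wc-u , wc-v) , (a wa , wa-v , wa-u)
    where
    wc : Fin (2 * K)
    wc = index (μL u) (μL-in-range u uu)
    wa : Fin (2 * K)
    wa = index (ρL v) (ρL-in-range v vv)
    wc-u : suc (toℕ wc) ≤ μ̂ K (positionOf u uu)
    wc-u = subst₂ _≤_ (sym (index-pos _ (μL-in-range u uu))) (sym (μ̂-positionOf u uu)) ≤-refl
    wc-v : ¬ suc (toℕ wc) ≤ μ̂ K (positionOf v vv)
    wc-v adj = <⇒≱ μv<μu (subst₂ _≤_ (index-pos _ (μL-in-range u uu)) (μ̂-positionOf v vv) adj)
    wa-v : suc (toℕ wa) ≤ ρ̂ K (positionOf v vv)
    wa-v = subst₂ _≤_ (sym (index-pos _ (ρL-in-range v vv))) (sym (ρ̂-positionOf v vv)) ≤-refl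
    wa-u : ¬ suc (toℕ wa) ≤ ρ̂ K (positionOf u uu)
    wa-u adj = <⇒≱ ρu<ρv (subst₂ _≤_ (index-pos _ (ρL-in-range v vv)) (ρ̂-positionOf u uu) adj)

is-B? : ∀ {n} (Z : Vertex n) → part Z ≡ B ⊎ part Z ≢ B
is-B? (a _) = inj₂ λ ()
is-B? (b _) = inj₁ refl
is-B? (c _) = inj₂ λ ()

b-injective : ∀ {n} {Y Y′ : Fin n} → b Y ≡ b Y′ → Y ≡ Y′
b-injective refl = refl

module Embedding (q r : ℕ) (f : Vertex (2 * (4 + q)) → Vertex (2 * (4 + r)))
  (f-injective : Injective _≡_ _≡_ f)
  (f-induced : ∀ u v → (Adj (4 + q) u v → Adj (4 + r) (f u) (f v)) × (Adj (4 + r) (f u) (f v) → Adj (4 + q) u v))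
  where
  module Pq = Profile q
  module Pr = Profile r
  module Gq = CrossingGraph q
  open InducedEmbedding (4 + q) (4 + r) f f-induced

  -- a₁ is adjacent to every B-vertex because ρ* ≥ 1, hence so is f(a₁) to their images
  a₁-adjacent : ∀ X → Adj (4 + q) (a zero) (b X)
  a₁-adjacent X = subst (1 ≤_) (sym (Pq.ρ̂-labelAt X)) (proj₁ (Pq.ρL-in-range _ (Pq.labelAt-valid X)))

  f-a₁-adjacent : ∀ X → Adj (4 + r) (f (a zero)) (f (b X))
  f-a₁-adjacent X = proj₁ (f-induced (a zero) (b X)) (a₁-adjacent X)

  image : ∀ v → Pq.Valid v → Vertex (2 * (4 + r))
  image v vv = f (b (Pq.positionOf v vv))

  crossing-images : ∀ {u v} uu vv → Gq.Edge u v → MutuallySeparated (4 + r) (image u uu) (image v vv)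
  crossing-images {u} {v} uu vv e =
    preserves-mutual-separation (SeparationOfB.crosses⇒mutually-separated q u v uu vv (Gq.edge⇒crosses e))

  a₁↦B-impossible : part (f (a zero)) ≡ B → ⊥
  a₁↦B-impossible a₁↦B = pigeonhole (A-or-C (outside-B apex tt)) (A-or-C (outside-B top₁ tt)) (A-or-C (outside-B top₂ tt))
                                    (apart tt tt Gq.apex-top₁) (apart tt tt Gq.apex-top₂) (apart tt tt Gq.top₁-top₂)
    where
    outside-B : ∀ v vv → part (image v vv) ≢ B
    outside-B v vv = B-neighbour (4 + r) _ _ (f-a₁-adjacent _) a₁↦B
    apart : ∀ {u v} uu vv → Gq.Edge u v → part (image u uu) ≢ part (image v vv)
    apart {u} {v} uu vv e = nested (4 + r) _ _ (outside-B u uu) (crossing-images uu vv e)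

  module B↦B (a₁↦nonB : part (f (a zero)) ≢ B) where
    h-spec : ∀ X → Σ (Fin (2 * (4 + r))) λ Y → f (b X) ≡ b Y
    h-spec X = non-B-neighbour (4 + r) _ _ (f-a₁-adjacent X) a₁↦nonB

    h : Fin (2 * (4 + q)) → Fin (2 * (4 + r))
    h X = proj₁ (h-spec X)

    f-b : ∀ X → f (b X) ≡ b (h X)
    f-b X = proj₂ (h-spec X)

    h-injective : Injective _≡_ _≡_ h
    h-injective {X} {X′} hX≡hX′ = b-injective (f-injective (trans (f-b X) (trans (cong b hX≡hX′) (sym (f-b X′)))))

    q≤r : q ≤ r
    q≤r = +-cancelˡ-≤ 4 q r (double-cancel-≤ (subst₂ _≤_ (2*≡double (4 + q)) (2*≡double (4 + r)) (injective⇒≤ h-injective)))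

    H : ∀ v → Pq.Valid v → Label
    H v vv = Pr.labelAt (h (Pq.positionOf v vv))

    H-injective : ∀ u v uu vv → H u uu ≡ H v vv → Pq.pos u ≡ Pq.pos v
    H-injective u v uu vv Hu≡Hv =
      trans (sym (Pq.positionOf-pos u uu)) (trans (cong (suc ∘ toℕ) (h-injective (Pr.labelAt-injective Hu≡Hv))) (Pq.positionOf-pos v vv))

    H-adjacent : ∀ {u v} uu vv → Gq.Edge u v → CrossingGraph.Adjacent r (H u uu) (H v vv)
    H-adjacent {u} {v} uu vv e = SeparationOfB.mutually-separated⇒adjacent r _ _
      (subst₂ (MutuallySeparated (4 + r)) (f-b (Pq.positionOf u uu)) (f-b (Pq.positionOf v vv)) (crossing-images uu vv e))

    r≤q : r ≤ q
    r≤q = Rigidity.r≤q q r H (λ v vv → Pr.labelAt-valid (h (Pq.positionOf v vv))) H-injective H-adjacent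

  same-size : q ≡ r
  same-size with is-B? (f (a zero))
  ... | inj₁ a₁↦B    = ⊥-elim (a₁↦B-impossible a₁↦B)
  ... | inj₂ a₁↦nonB = ≤-antisym (B↦B.q≤r a₁↦nonB) (B↦B.r≤q a₁↦nonB)

mainTheorem10 : (j k : ℕ) → 4 ≤ j → 4 ≤ k → j ≢ k → ¬ InducedSub j k
mainTheorem10 _ _ (s≤s (s≤s (s≤s (s≤s (z≤n {q}))))) (s≤s (s≤s (s≤s (s≤s (z≤n {r}))))) j≢k (f , f-injective , f-induced) =
  j≢k (cong (4 +_) (Embedding.same-size q r f f-injective f-induced))
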